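{- Let $G=(V,E)$ be a connected simple undirected graph whose vertex set carries a fixed total order $<$, and let $S$ be a connected bipartite vertex set of $G$. Then for any two distinct $u,v\in C(S,G)$, $$\mathcal{S}_{\mathrm{ind}}(G(S,\ge u),\,S\cup\{u\})\cap \mathcal{S}_{\mathrm{ind}}(G(S,\ge v),\,S\cup\{v\})=\emptyset.$$
   Context: A connected bipartite vertex set of a graph $H$ is a nonempty vertex set $S$ such that the induced subgraph $H[S]$ is connected and bipartite (no odd cycle). For a graph $H$ and vertex set $S$, $\mathcal{S}_{\mathrm{ind}}(H,S)$ is the collection of connected bipartite vertex sets $S'$ of $H$ with $S\subseteq S'$. A child generator of $S$ in $H$ is a vertex $v\notin S$ of $H$ such that $S\cup\{v\}$ is a connected bipartite vertex set of $H$; $C(S,H)$ denotes the set of child generators. For $u\in C(S,G)$, $G(S,\ge u)$ denotes the graph $G\setminus\{v\in C(S,G): v<u\}$, i.e. $G$ with the child generators of $S$ smaller than $u$ (and their incident edges) deleted. -}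

module Defs where

open import Level using (0ℓ)
open import Data.Nat using (ℕ)
open import Data.Fin using (Fin; _<_)
open import Data.Bool using (Bool)
open import Data.Product using (Σ; _×_; ∃)
open import Relation.Nullary using (¬_)
open import Relation.Binary.PropositionalEquality using (_≢_)
open import Relation.Unary using (Pred; _∈_; _∉_; _⊆_; _∪_; ｛_｝; Satisfiable; U)

-- A finite simple undirected graph on the totally ordered vertex set Fin n
-- (ordered by Data.Fin._<_).  Adjacency is symmetric and irreflexive.
record Graph (n : ℕ) : Set₁ where
  field
    Adj    : Fin n → Fin n → Set
    sym    : ∀ {x y} → Adj x y → Adj y x
    irrefl : ∀ {x} → ¬ Adj x x
open Graph public

VSet : ℕ → Set₁
VSet n = Pred (Fin n) 0ℓ

module _ {n : ℕ} (G : Graph n) where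

  data WalkIn (S : VSet n) : Fin n → Fin n → Set where
    here : ∀ {x} → x ∈ S → WalkIn S x x
    step : ∀ {x y z} → x ∈ S → Adj G x y → WalkIn S y z → WalkIn S x z

  InducedConnected : VSet n → Set
  InducedConnected S = ∀ x y → x ∈ S → y ∈ S → WalkIn S x y

  InducedBipartite : VSet n → Set
  InducedBipartite S =
    Σ (Fin n → Bool) λ c → ∀ x y → x ∈ S → y ∈ S → Adj G x y → c x ≢ c y

  Connected : Set
  Connected = InducedConnected U

  -- Subgraphs H of G obtained by deleting vertices are represented by
  -- their vertex set W (H = G[W]); then H[S'] = G[S'] for S' ⊆ W.

  CBS : VSet n → VSet n → Set
  CBS W S' = S' ⊆ W × Satisfiable S' × InducedConnected S' × InducedBipartite S'

  Sind : VSet n → VSet n → Pred (VSet n) _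
  Sind W S S' = CBS W S' × S ⊆ S'

  ChildGen : VSet n → VSet n → VSet n
  ChildGen W S v = v ∈ W × v ∉ S × CBS W (S ∪ ｛ v ｝)

  Ge : VSet n → Fin n → VSet n
  Ge S u w = ¬ (ChildGen U S w × w < u)

module Submission where

-- Let u ≠ v be child generators of S, say u < v.  Every set S′ in
-- 𝒮_ind(G(S,≥u), S ∪ {u}) contains u.  But u is a child generator of S
-- smaller than v, so u is deleted in G(S,≥v), and no member of
-- 𝒮_ind(G(S,≥v), S ∪ {v}) can contain it.

open import Defs
open import Data.Nat using (ℕ)
open import Data.Fin using (Fin; _<_)
open import Data.Fin.Properties using (<-cmp)
open import Data.Empty using (⊥)
open import Data.Sum using (inj₂)
open import Data.Product using (_,_)
open import Relation.Binary.Definitions using (tri<; tri≈; tri>)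
open import Relation.Binary.PropositionalEquality using (_≢_; refl)
open import Relation.Unary using (U; ｛_｝; _∪_; _∈_; _∉_)

module _ {n : ℕ} (G : Graph n) where

  added-vertex-∈ : ∀ {W S S′ : VSet n} {u : Fin n} →
    Sind G W (S ∪ ｛ u ｝) S′ → u ∈ S′
  added-vertex-∈ (_ , S∪u⊆S′) = S∪u⊆S′ (inj₂ refl)

  smaller-generator-∉ : ∀ {S T S′ : VSet n} {u w : Fin n} →
    ChildGen G U S w → w < u → Sind G (Ge G S u) T S′ → w ∉ S′
  smaller-generator-∉ cw w<u ((S′⊆Ge , _) , _) w∈S′ = S′⊆Ge w∈S′ (cw , w<u)

  disjoint-ordered : ∀ {S S′ : VSet n} {u v : Fin n} →
    ChildGen G U S u → u < v →
    Sind G (Ge G S u) (S ∪ ｛ u ｝) S′ →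
    Sind G (Ge G S v) (S ∪ ｛ v ｝) S′ → ⊥
  disjoint-ordered cu u<v in-u in-v =
    smaller-generator-∉ cu u<v in-v (added-vertex-∈ in-u)

lemma1 : ∀ {n} (G : Graph n) → Connected G →
    ∀ (S : VSet n) → CBS G U S →
    ∀ (u v : Fin n) → ChildGen G U S u → ChildGen G U S v → u ≢ v →
    ∀ (S′ : VSet n) →
    Sind G (Ge G S u) (S ∪ ｛ u ｝) S′ →
    Sind G (Ge G S v) (S ∪ ｛ v ｝) S′ → ⊥
lemma1 G _ S _ u v cu cv u≢v S′ in-u in-v with <-cmp u v
... | tri< u<v _ _ = disjoint-ordered G cu u<v in-u in-v
... | tri≈ _ u≡v _ = u≢v u≡v
... | tri> _ _ v<u = disjoint-ordered G cv v<u in-v in-u
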